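{- For any family $\mathcal{G}$ of finite simple graphs, the set $\{\tau(L(G)) : G \in \mathcal{G}\}$ is bounded if and only if the set $\{\chi(G) : G \in \mathcal{G}\}$ is bounded.
   Context: $\chi(G)$ is the chromatic number of $G$. The line graph $L(G)$ of $G$ has vertex set $E(G)$, two vertices being adjacent iff the corresponding edges share an endpoint. An interval graph is the intersection graph of a family of intervals on the real line. The track number $\tau(H)$ of a graph $H$ is the minimum number of interval graphs whose union is $H$. -}

module Defs where

open import Data.Nat using (ℕ; _≤_; _<_)
open import Data.Fin using (Fin; toℕ)
open import Data.Bool using (Bool; true; false)
open import Data.Product using (Σ; ∃; _×_; _,_; proj₁; proj₂)
open import Data.Sum using (_⊎_)
open import Relation.Binary.PropositionalEquality using (_≡_; _≢_)
open import Function.Bundles using (_⇔_)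
open import Level using (0ℓ)

-- A finite simple graph on the vertex set Fin n:
-- symmetric, irreflexive, Boolean (hence decidable, proof-irrelevant) adjacency.
record Graph : Set where
  field
    n      : ℕ
    adj    : Fin n → Fin n → Bool
    sym    : ∀ i j → adj i j ≡ adj j i
    irrefl : ∀ i → adj i i ≡ false
open Graph public

Adj : (G : Graph) → Fin (n G) → Fin (n G) → Set
Adj G i j = adj G i j ≡ true

Colorable : Graph → ℕ → Set
Colorable G k = Σ (Fin (n G) → Fin k) λ c → ∀ i j → Adj G i j → c i ≢ c j

IsChromaticNumber : Graph → ℕ → Set
IsChromaticNumber G k = Colorable G k × (∀ j → Colorable G j → k ≤ j)

-- E(G): each edge {i,j} represented once, as the pair (i , j) with i < j
Edge : Graph → Set
Edge G = Σ (Fin (n G) × Fin (n G)) λ p → (toℕ (proj₁ p) < toℕ (proj₂ p)) × Adj G (proj₁ p) (proj₂ p)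

end₁ end₂ : {G : Graph} → Edge G → Fin (n G)
end₁ e = proj₁ (proj₁ e)
end₂ e = proj₂ (proj₁ e)

LineAdj : (G : Graph) → Edge G → Edge G → Set
LineAdj G e f = e ≢ f × ((end₁ {G} e ≡ end₁ {G} f ⊎ end₁ {G} e ≡ end₂ {G} f) ⊎ (end₂ {G} e ≡ end₁ {G} f ⊎ end₂ {G} e ≡ end₂ {G} f))

-- closed interval [a , b] with natural-number endpoints, a ≤ b
Interval : Set
Interval = ℕ × ℕ

ValidInterval : Interval → Set
ValidInterval I = proj₁ I ≤ proj₂ I

Intersect : Interval → Interval → Set
Intersect I J = (proj₁ I ≤ proj₂ J) × (proj₁ J ≤ proj₂ I)

IsIntervalGraph : (V : Set) → (V → V → Set) → Set
IsIntervalGraph V R =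
  Σ (V → Interval) λ I → (∀ v → ValidInterval (I v)) ×
    (∀ u v → R u v ⇔ (u ≢ v × Intersect (I u) (I v)))

UnionOfIntervalGraphs : (V : Set) → (V → V → Set) → ℕ → Set₁
UnionOfIntervalGraphs V E t =
  Σ (Fin t → V → V → Set) λ H → (∀ i → IsIntervalGraph V (H i)) ×
    (∀ u v → E u v ⇔ ∃ λ i → H i u v)

IsTrackNumber : (V : Set) → (V → V → Set) → ℕ → Set₁
IsTrackNumber V E t =
  UnionOfIntervalGraphs V E t × (∀ s → UnionOfIntervalGraphs V E s → t ≤ s)

IsLineTrackNumber : Graph → ℕ → Set₁
IsLineTrackNumber G t = IsTrackNumber (Edge G) (LineAdj G) t

-- If c properly colors G with k colors, L(G) is the union of k interval graphs: in the γ-th one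
-- every edge is the point given by its endpoint of color γ (if any), and two edges share a
-- vertex v exactly when they coincide in the graph of color c(v).
--
-- Conversely, let L(G) be the union of t interval graphs and call edges wx, xy with w < x < y
-- consecutive.  An edge coloring with 4^t colors that separates consecutive edges gives a proper
-- coloring with 2^(4^t) colors, by coloring each vertex with the set of colors of the edges
-- entering it from below (the shift-graph argument).  In one interval graph the edges covering a
-- point form a clique of L(G), that is, a star or a triangle.  At a star point "the upper end of e
-- is the center", and at a triangle point "some covering edge ends where e starts", is a local
-- 2-coloring of the covering edges that separates consecutive ones.  Between two points of the
-- same kind sharing two edges these local colorings agree (the center of a star, and a triangle,
-- are determined by two of their edges), so sweeping along the line glues them into two global
-- 2-colorings: 4 colors per interval graph.
--
-- Both bounds pass to the least values χ and τ.  Constructively a least value exists only up to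
-- double negation, which suffices because the goals are decidable inequalities.

module Submission where

open import Defs renaming (sym to adj-sym)
open import Axiom.UniquenessOfIdentityProofs using (module Decidable⇒UIP)
open import Data.Bool using (Bool; true; false; _xor_) renaming (_≟_ to _≟ᵇ_)
open import Data.Bool.Properties using (xor-assoc; xor-same; xor-identityʳ; not-injective)
open import Data.Fin using (Fin; toℕ; combine; funToFin; finToFun) renaming (zero to fzero; suc to fsuc)
import Data.Fin.Properties as Fin
open import Data.Maybe using (Maybe; just; nothing)
open import Data.Nat using (ℕ; zero; suc; _≤_; _<_; _^_; s≤s)
open import Data.Nat.Induction using (<-wellFounded)
open import Data.Nat.Properties
open import Data.Product using (∃; _×_; _,_; proj₁; proj₂)
open import Data.Sum using (_⊎_; inj₁; inj₂)
open import Function using (_∘_; id)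
open import Function.Bundles using (_⇔_; mk⇔; Equivalence)
open import Induction.WellFounded using (Acc; acc)
open import Level using (0ℓ)
open import Relation.Binary.Definitions using (tri<; tri≈; tri>)
open import Relation.Binary.PropositionalEquality
open import Relation.Nullary.Decidable
  using ( Dec; yes; no; does; map′; _×-dec_; _⊎-dec_; _→-dec_; ¬?
        ; dec-true; does-⇔; decidable-stable; ¬¬-excluded-middle )
open import Relation.Nullary.Negation using (¬_; contradiction)
open import Relation.Unary using (Pred; Decidable)

xor-cancelˡ : ∀ x {y z} → x xor y ≡ x xor z → y ≡ z
xor-cancelˡ false eq = eq
xor-cancelˡ true  eq = not-injective eq

xor-cancelʳ : ∀ x y → (x xor y) xor y ≡ x
xor-cancelʳ x y = trans (xor-assoc x y y) (trans (cong (x xor_) (xor-same y)) (xor-identityʳ x))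

≡⇒xor≡false : ∀ {x y} → x ≡ y → x xor y ≡ false
≡⇒xor≡false {x} refl = xor-same x

does-true⇒ : ∀ {A : Set} (a? : Dec A) → does a? ≡ true → A
does-true⇒ (yes a) _ = a

does-distinct : ∀ {A B : Set} (a? : Dec A) (b? : Dec B) → A → ¬ B → does a? ≢ does b?
does-distinct (yes _) (no _)  _ _  ()
does-distinct (no ¬a) _       a _  = contradiction a ¬a
does-distinct (yes _) (yes b) _ ¬b = contradiction b ¬b

bit : Bool → Fin 2
bit false = fzero
bit true  = fsuc fzero

bit-injective : ∀ {x y} → bit x ≡ bit y → x ≡ y
bit-injective {false} {false} _ = refl
bit-injective {true}  {true}  _ = refl

pairCode : Bool × Bool → Fin 4
pairCode (x , y) = combine (bit x) (bit y)

pairCode-injective : ∀ {c d} → pairCode c ≡ pairCode d → c ≡ d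
pairCode-injective {x , y} {x′ , y′} eq with Fin.combine-injective (bit x) (bit y) (bit x′) (bit y′) eq
... | x≡x′ , y≡y′ = cong₂ _,_ (bit-injective x≡x′) (bit-injective y≡y′)

funToFin-injective : ∀ {m k} {f g : Fin m → Fin k} → funToFin f ≡ funToFin g → ∀ i → f i ≡ g i
funToFin-injective {f = f} {g} eq i = begin
  f i                     ≡⟨ Fin.finToFun-funToFin f i ⟨
  finToFun (funToFin f) i ≡⟨ cong (λ c → finToFun c i) eq ⟩
  finToFun (funToFin g) i ≡⟨ Fin.finToFun-funToFin g i ⟩
  g i                     ∎
  where open ≡-Reasoning

IsLeast : ∀ {ℓ} → (ℕ → Set ℓ) → ℕ → Set ℓ
IsLeast P k = P k × (∀ j → P j → k ≤ j)

¬¬-least : ∀ {ℓ} {P : ℕ → Set ℓ} {m} → P m → ¬ ¬ ∃ (IsLeast P)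
¬¬-least {P = P} pm = go (<-wellFounded _) pm
  where
    go : ∀ {m} → Acc _<_ m → P m → ¬ ¬ ∃ (IsLeast P)
    go {m} (acc smaller) pm no-least = ¬¬-excluded-middle {A = ∃ λ j → j < m × P j} λ where
      (yes (j , j<m , pj)) → go (smaller j<m) pj no-least
      (no nothing-below)   →
        no-least (m , pm , λ j pj → ≮⇒≥ λ j<m → nothing-below (j , j<m , pj))

least-transfer : ∀ {a b} {P : ℕ → Set a} {Q : ℕ → Set b} {f : ℕ → ℕ} {B} →
  (∀ {m m′} → m ≤ m′ → f m ≤ f m′) → (∀ {m} → P m → Q (f m)) → ∃ P →
  (∀ k → IsLeast P k → k ≤ B) → ∀ j → IsLeast Q j → j ≤ f B
least-transfer f-mono P⇒Q (_ , pm) bound j (_ , j-least) =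
  decidable-stable (j ≤? _) λ j≰fB → ¬¬-least pm λ (k , k-least) →
    j≰fB (≤-trans (j-least _ (P⇒Q (proj₁ k-least))) (f-mono (bound k k-least)))

_∈ᴵ_ : ℕ → Interval → Set
q ∈ᴵ I = proj₁ I ≤ q × q ≤ proj₂ I

_∈ᴵ?_ : ∀ q I → Dec (q ∈ᴵ I)
q ∈ᴵ? I = (proj₁ I ≤? q) ×-dec (q ≤? proj₂ I)

common-point⇒intersect : ∀ {q I J} → q ∈ᴵ I → q ∈ᴵ J → Intersect I J
common-point⇒intersect (lI≤q , q≤rI) (lJ≤q , q≤rJ) = ≤-trans lI≤q q≤rJ , ≤-trans lJ≤q q≤rI

intersect⇒common-point : ∀ {I J} → ValidInterval I → ValidInterval J → Intersect I J →
  ∃ λ q → q ∈ᴵ I × q ∈ᴵ J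
intersect⇒common-point vI vJ (lI≤rJ , lJ≤rI) =
  _ , (m≤m⊔n _ _ , ⊔-lub vI lJ≤rI) , (m≤n⊔m _ _ , ⊔-lub lI≤rJ vJ)

module Gluing
  {E : Set} (search : ∀ {P : Pred E 0ℓ} → Decidable P → Dec (∃ P))
  (I : E → Interval) (Marked : Pred ℕ 0ℓ) (marked? : Decidable Marked) (ν : ℕ → E → Bool)
  (coherent : ∀ {p q e f} → Marked p → Marked q → p ∈ᴵ I e → q ∈ᴵ I e → p ∈ᴵ I f → q ∈ᴵ I f →
              ν p e xor ν q e ≡ ν p f xor ν q f)
  where

  shift : ℕ → ℕ → Bool
  shift p q with search (λ e → (p ∈ᴵ? I e) ×-dec (q ∈ᴵ? I e))
  ... | yes (e , _) = ν p e xor ν q e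
  ... | no _        = false

  shift-spec : ∀ {p q e} → Marked p → Marked q → p ∈ᴵ I e → q ∈ᴵ I e → shift p q ≡ ν p e xor ν q e
  shift-spec {p} {q} mp mq pe qe with search (λ e → (p ∈ᴵ? I e) ×-dec (q ∈ᴵ? I e))
  ... | yes (_ , pe′ , qe′) = coherent mp mq pe′ qe′ pe qe
  ... | no none             = contradiction (_ , pe , qe) none

  extend : ℕ → Maybe (ℕ × Bool) → Bool
  extend q nothing        = false
  extend q (just (p , s)) = s xor shift p q

  -- the last marked point below q, paired with its potential
  previous : ℕ → Maybe (ℕ × Bool)
  previous zero = nothing
  previous (suc q) with marked? q
  ... | yes _ = just (q , extend q (previous q))
  ... | no _  = previous q

  potential : ℕ → Bool
  potential q = extend q (previous q)

  previous-spec : ∀ {p} q → p < q → Marked p →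
    ∃ λ p′ → previous q ≡ just (p′ , potential p′) × p ≤ p′ × p′ < q × Marked p′
  previous-spec {p} (suc q) p<1+q mp with marked? q
  ... | yes mq = q , refl , ≤-pred p<1+q , n<1+n q , mq
  ... | no ¬mq with m≤n⇒m<n∨m≡n (≤-pred p<1+q)
  ...   | inj₂ refl = contradiction mp ¬mq
  ...   | inj₁ p<q with previous-spec q p<q mp
  ...     | p′ , prev≡ , p≤p′ , p′<q , mp′ = p′ , prev≡ , p≤p′ , m<n⇒m<1+n p′<q , mp′

  telescope : ∀ {p q e} → Acc _<_ q → p ≤ q → Marked p → Marked q → p ∈ᴵ I e → q ∈ᴵ I e →
    potential q xor ν q e ≡ potential p xor ν p e
  telescope {p} {q} {e} (acc smaller) p≤q mp mq pe qe with m≤n⇒m<n∨m≡n p≤q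
  ... | inj₂ refl = refl
  ... | inj₁ p<q with previous-spec q p<q mp
  ...   | p′ , prev≡ , p≤p′ , p′<q , mp′ = begin
    potential q xor ν q e                            ≡⟨ cong (λ r → extend q r xor ν q e) prev≡ ⟩
    (potential p′ xor shift p′ q) xor ν q e          ≡⟨ cong (λ s → (potential p′ xor s) xor ν q e)
                                                           (shift-spec mp′ mq p′e qe) ⟩
    (potential p′ xor (ν p′ e xor ν q e)) xor ν q e  ≡⟨ xor-assoc (potential p′) _ (ν q e) ⟩
    potential p′ xor ((ν p′ e xor ν q e) xor ν q e)  ≡⟨ cong (potential p′ xor_) (xor-cancelʳ _ _) ⟩
    potential p′ xor ν p′ e                          ≡⟨ telescope (smaller p′<q) p≤p′ mp mp′ pe p′e ⟩
    potential p xor ν p e                            ∎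
    where
      open ≡-Reasoning
      p′e : p′ ∈ᴵ I e
      p′e = ≤-trans (proj₁ pe) p≤p′ , ≤-trans (<⇒≤ p′<q) (proj₂ qe)

  readOff : E → Maybe (ℕ × Bool) → Bool
  readOff e nothing        = false
  readOff e (just (p , s)) = s xor ν p e

  glue : E → Bool
  glue e = readOff e (previous (suc (proj₂ (I e))))

  glue-spec : ∀ {q e} → Marked q → q ∈ᴵ I e → glue e ≡ potential q xor ν q e
  glue-spec {q} {e} mq qe with previous-spec (suc (proj₂ (I e))) (s≤s (proj₂ qe)) mq
  ... | p′ , prev≡ , q≤p′ , p′≤r , mp′ =
    trans (cong (readOff e) prev≡) (telescope (<-wellFounded p′) q≤p′ mq mp′ qe p′e)
    where
      p′e : p′ ∈ᴵ I e
      p′e = ≤-trans (proj₁ qe) q≤p′ , ≤-pred p′≤r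

  glue-separates : ∀ {q e f} → Marked q → q ∈ᴵ I e → q ∈ᴵ I f → ν q e ≢ ν q f → glue e ≢ glue f
  glue-separates {q} mq qe qf ν≢ glue≡ =
    ν≢ (xor-cancelˡ (potential q) (trans (sym (glue-spec mq qe)) (trans glue≡ (glue-spec mq qf))))

module EdgeTheory (G : Graph) where

  V : Set
  V = Fin (n G)

  low high : Edge G → V
  low  = end₁ {G}
  high = end₂ {G}

  low<high : ∀ e → toℕ (low e) < toℕ (high e)
  low<high e = proj₁ (proj₂ e)

  Consecutive : Edge G → Edge G → Set
  Consecutive e f = high e ≡ low f

  low≢high : ∀ e → low e ≢ high e
  low≢high e = Fin.<⇒≢ (low<high e)

  Adj-irrefl : ∀ {x} → ¬ Adj G x x
  Adj-irrefl {x} a with () ← trans (sym a) (irrefl G x)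

  Adj-sym : ∀ {x y} → Adj G x y → Adj G y x
  Adj-sym {x} {y} a = trans (adj-sym G y x) a

  Edge-≡ : ∀ {e f} → low e ≡ low f → high e ≡ high f → e ≡ f
  Edge-≡ {(a , b) , a<b , ab} {(.a , .b) , a<b′ , ab′} refl refl =
    cong₂ (λ p q → (a , b) , p , q) (<-irrelevant a<b a<b′) (Decidable⇒UIP.≡-irrelevant _≟ᵇ_ ab ab′)

  _≟ₑ_ : (e f : Edge G) → Dec (e ≡ f)
  e ≟ₑ f = map′ (λ (l≡ , h≡) → Edge-≡ l≡ h≡) (λ e≡f → cong low e≡f , cong high e≡f)
                ((low e Fin.≟ low f) ×-dec (high e Fin.≟ high f))

  any-edge? : ∀ {P : Pred (Edge G) 0ℓ} → Decidable P → Dec (∃ P)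
  any-edge? {P} P? =
    map′ (λ (a , b , h , p) → ((a , b) , h) , p) (λ (((a , b) , h) , p) → a , b , h , p)
         (Fin.any? λ a → Fin.any? λ b → edge-at a b)
    where
      edge-at : ∀ a b → Dec (∃ λ (h : toℕ a < toℕ b × Adj G a b) → P ((a , b) , h))
      edge-at a b with (toℕ a <? toℕ b) ×-dec (adj G a b ≟ᵇ true)
      ... | yes h = map′ (h ,_) (λ (_ , p) → subst P (Edge-≡ refl refl) p) (P? ((a , b) , h))
      ... | no ¬h = no (¬h ∘ proj₁)

  all-edge? : ∀ {P : Pred (Edge G) 0ℓ} → Decidable P → Dec (∀ e → P e)
  all-edge? P? = map′ (λ ¬∃¬ e → decidable-stable (P? e) (¬∃¬ ∘ (e ,_)))
                      (λ ∀P (e , ¬Pe) → ¬Pe (∀P e))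
                      (¬? (any-edge? (¬? ∘ P?)))

  ∃¬-edge : ∀ {P : Pred (Edge G) 0ℓ} → Decidable P → ¬ (∀ e → P e) → ∃ λ e → ¬ P e
  ∃¬-edge P? ¬∀P = decidable-stable (any-edge? (¬? ∘ P?))
    λ ¬∃¬ → ¬∀P λ e → decidable-stable (P? e) (¬∃¬ ∘ (e ,_))

  infix 4 _∈_ _∉_ _∈?_
  data _∈_ (v : V) (e : Edge G) : Set where
    is-low  : v ≡ low e  → v ∈ e
    is-high : v ≡ high e → v ∈ e

  _∉_ : V → Edge G → Set
  v ∉ e = ¬ v ∈ e

  _∈?_ : ∀ v e → Dec (v ∈ e)
  v ∈? e = map′ (λ { (inj₁ eq) → is-low eq ; (inj₂ eq) → is-high eq })
                (λ { (is-low eq) → inj₁ eq ; (is-high eq) → inj₂ eq })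
                ((v Fin.≟ low e) ⊎-dec (v Fin.≟ high e))

  ∈⇒low≤ : ∀ {v e} → v ∈ e → toℕ (low e) ≤ toℕ v
  ∈⇒low≤         (is-low refl)  = ≤-refl
  ∈⇒low≤ {e = e} (is-high refl) = <⇒≤ (low<high e)

  ∈⇒≤high : ∀ {v e} → v ∈ e → toℕ v ≤ toℕ (high e)
  ∈⇒≤high {e = e} (is-low refl)  = <⇒≤ (low<high e)
  ∈⇒≤high         (is-high refl) = ≤-refl

  ∈-two : ∀ {u v w e} → u ∈ e → v ∈ e → u ≢ v → w ∈ e → w ≡ u ⊎ w ≡ v
  ∈-two (is-low refl)  (is-low refl)  u≢v _             = contradiction refl u≢v
  ∈-two (is-high refl) (is-high refl) u≢v _             = contradiction refl u≢v
  ∈-two (is-low refl)  (is-high refl) _   (is-low w≡)  = inj₁ w≡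
  ∈-two (is-low refl)  (is-high refl) _   (is-high w≡) = inj₂ w≡
  ∈-two (is-high refl) (is-low refl)  _   (is-low w≡)  = inj₂ w≡
  ∈-two (is-high refl) (is-low refl)  _   (is-high w≡) = inj₁ w≡

  ∈-ordered : ∀ {u v e} → toℕ u < toℕ v → u ∈ e → v ∈ e → u ≡ low e × v ≡ high e
  ∈-ordered         _   (is-low u≡)    (is-high v≡)   = u≡ , v≡
  ∈-ordered         u<v (is-low refl)  (is-low refl)  = contradiction u<v (<-irrefl refl)
  ∈-ordered         u<v (is-high refl) (is-high refl) = contradiction u<v (<-irrefl refl)
  ∈-ordered {e = e} u<v (is-high refl) (is-low refl)  = contradiction (low<high e) (<-asym u<v)

  ordered-ends-determine : ∀ {u v e f} → toℕ u < toℕ v → u ∈ e → v ∈ e → u ∈ f → v ∈ f → e ≡ f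
  ordered-ends-determine u<v ue ve uf vf with ∈-ordered u<v ue ve | ∈-ordered u<v uf vf
  ... | u≡le , v≡he | u≡lf , v≡hf = Edge-≡ (trans (sym u≡le) u≡lf) (trans (sym v≡he) v≡hf)

  ends-determine : ∀ {u v e f} → u ≢ v → u ∈ e → v ∈ e → u ∈ f → v ∈ f → e ≡ f
  ends-determine {u} {v} u≢v ue ve uf vf with Fin.<-cmp u v
  ... | tri< u<v _ _ = ordered-ends-determine u<v ue ve uf vf
  ... | tri≈ _ u≡v _ = contradiction u≡v u≢v
  ... | tri> _ _ v<u = ordered-ends-determine v<u ve ue vf uf

  shared-unique : ∀ {x y e f} → e ≢ f → x ∈ e → x ∈ f → y ∈ e → y ∈ f → y ≡ x
  shared-unique {x} {y} e≢f xe xf ye yf =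
    decidable-stable (y Fin.≟ x) λ y≢x → e≢f (ends-determine y≢x ye xe yf xf)

  other-end : ∀ {v e} → v ∈ e → ∃ λ a → a ∈ e × a ≢ v
  other-end {e = e} (is-low refl)  = high e , is-high refl , low≢high e ∘ sym
  other-end {e = e} (is-high refl) = low e , is-low refl , low≢high e

  record Wedge (e f : Edge G) : Set where
    field
      x a b : V
      x∈e : x ∈ e
      x∈f : x ∈ f
      a∈e : a ∈ e
      b∈f : b ∈ f
      a≢x : a ≢ x
      b≢x : b ≢ x
      a≢b : a ≢ b

  wedge : ∀ {x e f} → e ≢ f → x ∈ e → x ∈ f → Wedge e f
  wedge {x} {e} {f} e≢f xe xf with other-end xe | other-end xf
  ... | a , ae , a≢x | b , bf , b≢x = record
    { x = x ; a = a ; b = b ; x∈e = xe ; x∈f = xf ; a∈e = ae ; b∈f = bf ; a≢x = a≢x ; b≢x = b≢x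
    ; a≢b = λ { refl → e≢f (ends-determine a≢x ae xe bf xf) } }

  lineAdj⇒shared : ∀ {e f} → LineAdj G e f → ∃ λ v → v ∈ e × v ∈ f
  lineAdj⇒shared (_ , inj₁ (inj₁ eq)) = _ , is-low refl  , is-low eq
  lineAdj⇒shared (_ , inj₁ (inj₂ eq)) = _ , is-low refl  , is-high eq
  lineAdj⇒shared (_ , inj₂ (inj₁ eq)) = _ , is-high refl , is-low eq
  lineAdj⇒shared (_ , inj₂ (inj₂ eq)) = _ , is-high refl , is-high eq

  shared⇒lineAdj : ∀ {v e f} → e ≢ f → v ∈ e → v ∈ f → LineAdj G e f
  shared⇒lineAdj e≢f (is-low refl)  (is-low eq)  = e≢f , inj₁ (inj₁ eq)
  shared⇒lineAdj e≢f (is-low refl)  (is-high eq) = e≢f , inj₁ (inj₂ eq)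
  shared⇒lineAdj e≢f (is-high refl) (is-low eq)  = e≢f , inj₂ (inj₁ eq)
  shared⇒lineAdj e≢f (is-high refl) (is-high eq) = e≢f , inj₂ (inj₂ eq)

  consecutive⇒lineAdj : ∀ {e f} → Consecutive e f → LineAdj G e f
  consecutive⇒lineAdj {e} c = (λ { refl → low≢high e (sym c) }) , inj₂ (inj₁ c)

module Track (G : Graph) (I : Edge G → Interval) (valid : ∀ e → ValidInterval (I e))
  (sound : ∀ {e f} → e ≢ f → Intersect (I e) (I f) → LineAdj G e f) where

  open EdgeTheory G

  covering-share : ∀ {q e f} → q ∈ᴵ I e → q ∈ᴵ I f → ∃ λ v → v ∈ e × v ∈ f
  covering-share {e = e} {f} qe qf with e ≟ₑ f
  ... | yes refl = low e , is-low refl , is-low refl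
  ... | no e≢f   = lineAdj⇒shared (sound e≢f (common-point⇒intersect qe qf))

  meets-at-other-end : ∀ {q e g x a} → q ∈ᴵ I e → q ∈ᴵ I g → x ∈ e → x ∉ g → a ∈ e → a ≢ x → a ∈ g
  meets-at-other-end qe qg xe x∉g ae a≢x with covering-share qe qg
  ... | v , ve , vg with ∈-two xe ae (a≢x ∘ sym) ve
  ...   | inj₁ refl = contradiction vg x∉g
  ...   | inj₂ refl = vg

  StarAt : ℕ → V → Set
  StarAt q y = ∀ g → q ∈ᴵ I g → y ∈ g

  starAt? : ∀ q y → Dec (StarAt q y)
  starAt? q y = all-edge? λ g → (q ∈ᴵ? I g) →-dec (y ∈? g)

  StarPoint : Pred ℕ 0ℓ
  StarPoint q = ∃ (StarAt q)

  starPoint? : Decidable StarPoint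
  starPoint? q = Fin.any? (starAt? q)

  star-center : ∀ {q e f x y} → StarPoint q → q ∈ᴵ I e → q ∈ᴵ I f → e ≢ f → x ∈ e → x ∈ f →
    StarAt q y ⇔ y ≡ x
  star-center {q} (c , c-star) qe qf e≢f xe xf = mk⇔
    (λ y-star → shared-unique e≢f xe xf (y-star _ qe) (y-star _ qf))
    (λ { refl → subst (StarAt q) (shared-unique e≢f xe xf (c-star _ qe) (c-star _ qf)) c-star })

  avoiding-edge : ∀ {q} → ¬ StarPoint q → ∀ x → ∃ λ g → q ∈ᴵ I g × x ∉ g
  avoiding-edge {q} ¬star x with ∃¬-edge (λ g → (q ∈ᴵ? I g) →-dec (x ∈? g)) (¬star ∘ (x ,_))
  ... | g , ¬[qg→xg] = g , qg , x∉g
    where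
      qg : q ∈ᴵ I g
      qg = decidable-stable (q ∈ᴵ? I g) λ ¬qg → ¬[qg→xg] λ qg → contradiction qg ¬qg
      x∉g : x ∉ g
      x∉g xg = ¬[qg→xg] λ _ → xg

  module _ {p e f} (w : Wedge e f) (pe : p ∈ᴵ I e) (pf : p ∈ᴵ I f) where
    open Wedge w

    avoiding-spans : ∀ {g} → p ∈ᴵ I g → x ∉ g → a ∈ g × b ∈ g
    avoiding-spans pg x∉g =
      meets-at-other-end pe pg x∈e x∉g a∈e a≢x , meets-at-other-end pf pg x∈f x∉g b∈f b≢x

    through-apex : ∀ {g} → ¬ StarPoint p → p ∈ᴵ I g → x ∈ g → g ≡ e ⊎ g ≡ f
    through-apex ¬star pg xg with avoiding-edge ¬star x
    ... | g₀ , pg₀ , x∉g₀ with avoiding-spans pg₀ x∉g₀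
    ...   | ag₀ , bg₀ with covering-share pg pg₀
    ...     | v , vg , vg₀ with ∈-two ag₀ bg₀ a≢b vg₀
    ...       | inj₁ refl = inj₁ (ends-determine a≢x vg xg a∈e x∈e)
    ...       | inj₂ refl = inj₂ (ends-determine b≢x vg xg b∈f x∈f)

  -- A clique of L(G) that is not a star is a triangle, so it is determined by any two of its edges.
  triangle-cover-⊆ : ∀ {p q e f g} (w : Wedge e f) → ¬ StarPoint p → ¬ StarPoint q →
    p ∈ᴵ I e → p ∈ᴵ I f → q ∈ᴵ I e → q ∈ᴵ I f → p ∈ᴵ I g → q ∈ᴵ I g
  triangle-cover-⊆ {q = q} {g = g} w ¬sp ¬sq pe pf qe qf pg with Wedge.x w ∈? g
  ... | yes xg with through-apex w pe pf ¬sp pg xg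
  ...   | inj₁ refl = qe
  ...   | inj₂ refl = qf
  triangle-cover-⊆ {q = q} {g = g} w ¬sp ¬sq pe pf qe qf pg | no x∉g with avoiding-edge ¬sq (Wedge.x w)
  ...   | g₁ , qg₁ , x∉g₁ with avoiding-spans w pe pf pg x∉g | avoiding-spans w qe qf qg₁ x∉g₁
  ...     | ag , bg | ag₁ , bg₁ = subst (λ h → q ∈ᴵ I h) (ends-determine (Wedge.a≢b w) ag₁ bg₁ ag bg) qg₁

  stable⇒coherent : ∀ (ν : ℕ → Edge G → Bool) {p q e f} → (e ≢ f → ∀ h → ν p h ≡ ν q h) →
    ν p e xor ν q e ≡ ν p f xor ν q f
  stable⇒coherent ν {e = e} {f} stable with e ≟ₑ f
  ... | yes refl = refl
  ... | no e≢f   = trans (≡⇒xor≡false (stable e≢f e)) (sym (≡⇒xor≡false (stable e≢f f)))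

  pointsToCenter : ℕ → Edge G → Bool
  pointsToCenter q e = does (starAt? q (high e))

  star-coherent : ∀ {p q e f} → StarPoint p → StarPoint q → p ∈ᴵ I e → q ∈ᴵ I e → p ∈ᴵ I f → q ∈ᴵ I f →
    pointsToCenter p e xor pointsToCenter q e ≡ pointsToCenter p f xor pointsToCenter q f
  star-coherent {p} {q} sp sq pe qe pf qf = stable⇒coherent pointsToCenter λ e≢f h →
    let x , xe , xf = covering-share pe pf in
    trans (does-⇔ (star-center sp pe pf e≢f xe xf) (starAt? p (high h)) (high h Fin.≟ x))
          (sym (does-⇔ (star-center sq qe qf e≢f xe xf) (starAt? q (high h)) (high h Fin.≟ x)))

  pointsToCenter-separates : ∀ {q e f} → StarPoint q → Consecutive e f → q ∈ᴵ I e → q ∈ᴵ I f →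
    pointsToCenter q e ≢ pointsToCenter q f
  pointsToCenter-separates {q} {e} {f} sq c qe qf =
    does-distinct (starAt? q (high e)) (starAt? q (high f))
      (Equivalence.from center refl)
      (λ f-star → low≢high f (trans (sym c) (sym (Equivalence.to center f-star))))
    where
      center : ∀ {y} → StarAt q y ⇔ y ≡ high e
      center = star-center sq qe qf (proj₁ (consecutive⇒lineAdj c)) (is-high refl) (is-low c)

  LeadsInto : ℕ → Edge G → Set
  LeadsInto q e = ∃ λ g → q ∈ᴵ I g × high g ≡ low e

  leadsInto? : ∀ q e → Dec (LeadsInto q e)
  leadsInto? q e = any-edge? λ g → (q ∈ᴵ? I g) ×-dec (high g Fin.≟ low e)

  leadsInto : ℕ → Edge G → Bool
  leadsInto q e = does (leadsInto? q e)

  triangle-coherent : ∀ {p q e f} → ¬ StarPoint p → ¬ StarPoint q →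
    p ∈ᴵ I e → q ∈ᴵ I e → p ∈ᴵ I f → q ∈ᴵ I f →
    leadsInto p e xor leadsInto q e ≡ leadsInto p f xor leadsInto q f
  triangle-coherent {p} {q} ¬sp ¬sq pe qe pf qf = stable⇒coherent leadsInto λ e≢f h →
    let x , xe , xf = covering-share pe pf
        w = wedge e≢f xe xf in
    does-⇔ (mk⇔ (λ (g , pg , hg) → g , triangle-cover-⊆ w ¬sp ¬sq pe pf qe qf pg , hg)
                (λ (g , qg , hg) → g , triangle-cover-⊆ w ¬sq ¬sp qe qf pe pf qg , hg))
           (leadsInto? p h) (leadsInto? q h)

  leadsInto-separates : ∀ {q e f} → Consecutive e f → q ∈ᴵ I e → q ∈ᴵ I f →
    leadsInto q f ≢ leadsInto q e
  leadsInto-separates {q} {e} {f} c qe qf =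
    does-distinct (leadsInto? q f) (leadsInto? q e) (e , qe , c) λ (g , qg , hg≡le) →
      let v , vg , vf = covering-share qg qf in
      <-irrefl refl (begin-strict
        toℕ v          ≤⟨ ∈⇒≤high vg ⟩
        toℕ (high g)   ≡⟨ cong toℕ hg≡le ⟩
        toℕ (low e)    <⟨ low<high e ⟩
        toℕ (high e)   ≡⟨ cong toℕ c ⟩
        toℕ (low f)    ≤⟨ ∈⇒low≤ vf ⟩
        toℕ v          ∎)
    where open ≤-Reasoning

  module StarGluing = Gluing any-edge? I StarPoint starPoint? pointsToCenter star-coherent
  module TriangleGluing =
    Gluing any-edge? I (¬_ ∘ StarPoint) (¬? ∘ starPoint?) leadsInto triangle-coherent

  trackColor : Edge G → Bool × Bool
  trackColor e = StarGluing.glue e , TriangleGluing.glue e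

  trackColor-separates : ∀ {e f} → Consecutive e f → Intersect (I e) (I f) → trackColor e ≢ trackColor f
  trackColor-separates {e} {f} c ef-meet color≡ with intersect⇒common-point (valid e) (valid f) ef-meet
  ... | q , qe , qf with starPoint? q
  ...   | yes sq = StarGluing.glue-separates sq qe qf
                     (pointsToCenter-separates sq c qe qf) (cong proj₁ color≡)
  ...   | no ¬sq = TriangleGluing.glue-separates ¬sq qf qe
                     (leadsInto-separates c qe qf) (cong proj₂ (sym color≡))

module _ (G : Graph) where
  open EdgeTheory G

  colorable⇒lineTracks : ∀ {k} → Colorable G k → UnionOfIntervalGraphs (Edge G) (LineAdj G) k
  colorable⇒lineTracks {k} (c , proper) = colorTrack , colorTrack-interval , λ _ _ → mk⇔ to from
    where
      endOfColor : Fin k → Edge G → V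
      endOfColor γ e with c (high e) Fin.≟ γ
      ... | yes _ = high e
      ... | no _  = low e

      endOfColor-∈ : ∀ γ e → endOfColor γ e ∈ e
      endOfColor-∈ γ e with c (high e) Fin.≟ γ
      ... | yes _ = is-high refl
      ... | no _  = is-low refl

      endOfColor-own : ∀ {v e} → v ∈ e → endOfColor (c v) e ≡ v
      endOfColor-own {e = e} (is-low refl) with c (high e) Fin.≟ c (low e)
      ... | yes same = contradiction (sym same) (proper _ _ (proj₂ (proj₂ e)))
      ... | no _     = refl
      endOfColor-own {e = e} (is-high refl) with c (high e) Fin.≟ c (high e)
      ... | yes _    = refl
      ... | no ¬refl = contradiction refl ¬refl

      point : Fin k → Edge G → Interval
      point γ e = toℕ (endOfColor γ e) , toℕ (endOfColor γ e)

      colorTrack : Fin k → Edge G → Edge G → Set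
      colorTrack γ e f = e ≢ f × Intersect (point γ e) (point γ f)

      colorTrack-interval : ∀ γ → IsIntervalGraph (Edge G) (colorTrack γ)
      colorTrack-interval γ = point γ , (λ _ → ≤-refl) , λ _ _ → mk⇔ id id

      to : ∀ {e f} → LineAdj G e f → ∃ λ γ → colorTrack γ e f
      to {e} {f} ef@(e≢f , _) with lineAdj⇒shared ef
      ... | v , ve , vf = c v , e≢f , ≤-reflexive (cong toℕ same) , ≤-reflexive (cong toℕ (sym same))
        where
          same : endOfColor (c v) e ≡ endOfColor (c v) f
          same = trans (endOfColor-own ve) (sym (endOfColor-own vf))

      from : ∀ {e f} → (∃ λ γ → colorTrack γ e f) → LineAdj G e f
      from {e} {f} (γ , e≢f , ≤₁ , ≤₂) = shared⇒lineAdj e≢f (endOfColor-∈ γ e)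
        (subst (_∈ f) (Fin.toℕ-injective (≤-antisym ≤₂ ≤₁)) (endOfColor-∈ γ f))

  module ShiftColoring {m} (c : Edge G → Fin m) (separates : ∀ {e f} → Consecutive e f → c e ≢ c f) where

    Incoming : V → Fin m → Set
    Incoming y γ = ∃ λ e → high e ≡ y × c e ≡ γ

    incoming? : ∀ y γ → Dec (Incoming y γ)
    incoming? y γ = any-edge? λ e → (high e Fin.≟ y) ×-dec (c e Fin.≟ γ)

    vertexColor : V → Fin (2 ^ m)
    vertexColor y = funToFin λ γ → bit (does (incoming? y γ))

    incoming-transfer : ∀ {x y γ} → vertexColor x ≡ vertexColor y → Incoming y γ → Incoming x γ
    incoming-transfer {x} {y} {γ} same in-y = does-true⇒ (incoming? x γ)
      (trans (bit-injective (funToFin-injective same γ)) (dec-true (incoming? y γ) in-y))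

    proper-upwards : ∀ {x y} → toℕ x < toℕ y → Adj G x y → vertexColor x ≢ vertexColor y
    proper-upwards {x} {y} x<y xy same with incoming-transfer same (((x , y) , x<y , xy) , refl , refl)
    ... | e , high≡x , c≡ = separates high≡x c≡

    proper : ∀ x y → Adj G x y → vertexColor x ≢ vertexColor y
    proper x y xy with Fin.<-cmp x y
    ... | tri< x<y _ _ = proper-upwards x<y xy
    ... | tri≈ _ refl _ = contradiction xy Adj-irrefl
    ... | tri> _ _ y<x = proper-upwards y<x (Adj-sym xy) ∘ sym

  consecutive-coloring⇒colorable : ∀ {m} (c : Edge G → Fin m) →
    (∀ {e f} → Consecutive e f → c e ≢ c f) → Colorable G (2 ^ m)
  consecutive-coloring⇒colorable c separates = vertexColor , proper
    where open ShiftColoring c separates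

  lineTracks⇒colorable : ∀ {t} → UnionOfIntervalGraphs (Edge G) (LineAdj G) t → Colorable G (2 ^ (4 ^ t))
  lineTracks⇒colorable {t} (H , H-interval , H-union) =
    consecutive-coloring⇒colorable edgeColor edgeColor-separates
    where
      interval : Fin t → Edge G → Interval
      interval i = proj₁ (H-interval i)

      represents : ∀ i {e f} → H i e f ⇔ (e ≢ f × Intersect (interval i e) (interval i f))
      represents i = proj₂ (proj₂ (H-interval i)) _ _

      module TrackOf (i : Fin t) = Track G (interval i) (proj₁ (proj₂ (H-interval i)))
        (λ e≢f meet → Equivalence.from (H-union _ _) (i , Equivalence.from (represents i) (e≢f , meet)))

      edgeColor : Edge G → Fin (4 ^ t)
      edgeColor e = funToFin λ i → pairCode (TrackOf.trackColor i e)

      edgeColor-separates : ∀ {e f} → Consecutive e f → edgeColor e ≢ edgeColor f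
      edgeColor-separates c same with Equivalence.to (H-union _ _) (consecutive⇒lineAdj c)
      ... | i , Hef = TrackOf.trackColor-separates i c (proj₂ (Equivalence.to (represents i) Hef))
                        (pairCode-injective (funToFin-injective same i))

  identityColoring : Colorable G (n G)
  identityColoring = id , λ x y xy → λ { refl → Adj-irrefl xy }

mainTheorem5 : (𝒢 : Graph → Set) →
    (∃ λ B → ∀ G → 𝒢 G → ∀ t → IsLineTrackNumber G t → t ≤ B)
      ⇔ (∃ λ B → ∀ G → 𝒢 G → ∀ k → IsChromaticNumber G k → k ≤ B)
mainTheorem5 𝒢 = mk⇔
  (λ (B , τ≤B) → 2 ^ (4 ^ B) , λ G G∈𝒢 →
    least-transfer (λ t≤t′ → ^-monoʳ-≤ 2 (^-monoʳ-≤ 4 t≤t′)) (lineTracks⇒colorable G)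
      (n G , colorable⇒lineTracks G (identityColoring G)) (τ≤B G G∈𝒢))
  (λ (B , χ≤B) → B , λ G G∈𝒢 →
    least-transfer id (colorable⇒lineTracks G) (n G , identityColoring G) (χ≤B G G∈𝒢))
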